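{- Every non-trivial connected threshold graph $G$ satisfies $\gamma_I^p(G)=2$.
   Context: A threshold graph is a graph that can be built from a single vertex by repeatedly adding either an isolated vertex or a vertex adjacent to all existing vertices (a dominating vertex). Non-trivial means having at least two vertices. For a graph $G=(V,E)$ and $v\in V$, $N(v)$ denotes the set of neighbours of $v$. A perfect Italian dominating function (PID-function) of $G$ is a function $f:V\to\{0,1,2\}$ such that for every vertex $v$ with $f(v)=0$ one has $\sum_{u\in N(v)} f(u)=2$. The weight of $f$ is $\sum_{v\in V} f(v)$; $\gamma_I^p(G)$ is the minimum weight of a PID-function of $G$. -}

module Defs where

open import Data.Nat using (ℕ; zero; suc; _+_; _≤_)
open import Data.Fin using (Fin; zero; suc; toℕ; punchIn)
open import Data.Bool using (Bool; true; false; if_then_else_)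
open import Data.Product using (Σ; ∃; _×_; _,_)
open import Data.Sum using (_⊎_)
open import Relation.Binary.PropositionalEquality using (_≡_)
open import Relation.Nullary using (¬_)

record Graph (n : ℕ) : Set where
  field
    Adj   : Fin n → Fin n → Bool
    sym   : ∀ u v → Adj u v ≡ Adj v u
    irrefl : ∀ v → Adj v v ≡ false
open Graph public

delete : ∀ {n} → Graph (suc n) → Fin (suc n) → Graph n
delete G v = record
  { Adj = λ i j → Adj G (punchIn v i) (punchIn v j)
  ; sym = λ i j → sym G (punchIn v i) (punchIn v j)
  ; irrefl = λ i → irrefl G (punchIn v i) }

Isolated : ∀ {n} → Graph n → Fin n → Set
Isolated G v = ∀ u → Adj G v u ≡ false

Dominating : ∀ {n} → Graph n → Fin n → Set
Dominating G v = ∀ u → ¬ (u ≡ v) → Adj G v u ≡ true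

-- Threshold graphs: built from a single vertex by repeatedly adding an
-- isolated or a dominating vertex. Read backwards: a graph is threshold
-- iff it has one vertex, or it has a vertex that is isolated or dominating
-- whose deletion leaves a threshold graph.
data Threshold : ∀ {n} → Graph n → Set where
  single : (G : Graph 1) → Threshold G
  add    : ∀ {n} (G : Graph (suc n)) (v : Fin (suc n)) →
           (Isolated G v ⊎ Dominating G v) →
           Threshold (delete G v) → Threshold G

data Walk {n} (G : Graph n) : Fin n → Fin n → Set where
  here : ∀ {u} → Walk G u u
  step : ∀ {u v w} → Adj G u v ≡ true → Walk G v w → Walk G u w

Connected : ∀ {n} → Graph n → Set
Connected G = ∀ u v → Walk G u v

∑ : ∀ {n} → (Fin n → ℕ) → ℕ
∑ {zero}  f = 0
∑ {suc n} f = f zero + ∑ (λ i → f (suc i))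

nbSum : ∀ {n} → Graph n → (Fin n → Fin 3) → Fin n → ℕ
nbSum G f v = ∑ (λ u → if Adj G v u then toℕ (f u) else 0)

IsPID : ∀ {n} → Graph n → (Fin n → Fin 3) → Set
IsPID G f = ∀ v → f v ≡ zero → nbSum G f v ≡ 2

weight : ∀ {n} → (Fin n → Fin 3) → ℕ
weight f = ∑ (λ v → toℕ (f v))

γIp≡ : ∀ {n} → Graph n → ℕ → Set
γIp≡ {n} G k = (Σ (Fin n → Fin 3) λ f → IsPID G f × weight f ≡ k)
         × (∀ f → IsPID G f → k ≤ weight f)

-- A connected threshold graph on at least two vertices cannot have been
-- finished with an isolated vertex, so it has a dominating vertex v; putting
-- 2 on v and 0 elsewhere is a PID-function of weight 2. Conversely every
-- PID-function has weight at least 2: a vertex labelled 0 sees weight 2 in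
-- its neighbourhood, and otherwise two vertices already carry weight 1 each.
module Submission where

open import Defs
open import Data.Nat using (ℕ; _≤_; zero; suc; _+_; z≤n; s≤s)
open import Data.Nat.Properties using (≤-refl; ≤-trans; +-mono-≤; m≤n+m; +-identityʳ)
open import Data.Fin using (Fin; zero; suc; toℕ; _≟_)
open import Data.Fin.Properties using (suc-injective)
open import Data.Bool using (Bool; true; false; if_then_else_)
open import Data.Product using (∃; _×_; _,_)
open import Data.Sum using (inj₁; inj₂)
open import Data.Empty using (⊥-elim)
open import Function using (_∘_)
open import Relation.Nullary using (¬_; yes; no)
open import Relation.Binary.PropositionalEquality
  using (_≡_; _≢_; refl; trans; cong; subst; module ≡-Reasoning)
  renaming (sym to ≡-sym)

∑-mono-≤ : ∀ {n} {f g : Fin n → ℕ} → (∀ i → f i ≤ g i) → ∑ f ≤ ∑ g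
∑-mono-≤ {zero}  f≤g = z≤n
∑-mono-≤ {suc n} f≤g = +-mono-≤ (f≤g zero) (∑-mono-≤ (λ i → f≤g (suc i)))

∑-zero : ∀ {n} (g : Fin n → ℕ) → (∀ w → g w ≡ 0) → ∑ g ≡ 0
∑-zero {zero}  g g≡0 = refl
∑-zero {suc n} g g≡0 rewrite g≡0 zero = ∑-zero (λ i → g (suc i)) (λ i → g≡0 (suc i))

∑-supported-at : ∀ {n} (g : Fin n → ℕ) v → (∀ w → w ≢ v → g w ≡ 0) → ∑ g ≡ g v
∑-supported-at g zero g≡0 =
  trans (cong (g zero +_) (∑-zero (λ i → g (suc i)) (λ i → g≡0 (suc i) λ ())))
        (+-identityʳ (g zero))
∑-supported-at g (suc v) g≡0 rewrite g≡0 zero (λ ()) =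
  ∑-supported-at (λ i → g (suc i)) v (λ w w≢v → g≡0 (suc w) (w≢v ∘ suc-injective))

if-≤ : (b : Bool) (k : ℕ) → (if b then k else 0) ≤ k
if-≤ true  k = ≤-refl
if-≤ false k = z≤n

nbSum≤weight : ∀ {n} (G : Graph n) f v → nbSum G f v ≤ weight f
nbSum≤weight G f v = ∑-mono-≤ (λ u → if-≤ (Adj G v u) (toℕ (f u)))

isPID⇒2≤weight : ∀ {m} (G : Graph (suc (suc m))) f → IsPID G f → 2 ≤ weight f
isPID⇒2≤weight G f pid = by-labels (f zero) refl (f (suc zero)) refl
  where
  via-zero-label : ∀ v → f v ≡ zero → 2 ≤ weight f
  via-zero-label v fv≡0 = subst (_≤ weight f) (pid v fv≡0) (nbSum≤weight G f v)

  by-labels : ∀ x → f zero ≡ x → ∀ y → f (suc zero) ≡ y → 2 ≤ weight f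
  by-labels zero    f0≡0 y       _    = via-zero-label zero f0≡0
  by-labels (suc _) _    zero    f1≡0 = via-zero-label (suc zero) f1≡0
  by-labels (suc a) f0≡x (suc _) f1≡y rewrite f0≡x | f1≡y =
    s≤s (≤-trans (s≤s z≤n) (m≤n+m _ (toℕ a)))

walk-from-isolated : ∀ {n} (G : Graph n) {v u} → Isolated G v → Walk G v u → v ≡ u
walk-from-isolated G iso here = refl
walk-from-isolated G iso (step {v = w} adj _) with trans (≡-sym adj) (iso w)
... | ()

connected⇒¬isolated : ∀ {m} (G : Graph (suc (suc m))) → Connected G → ∀ v → ¬ Isolated G v
connected⇒¬isolated G conn zero    iso with walk-from-isolated G iso (conn zero (suc zero))
... | ()
connected⇒¬isolated G conn (suc v) iso with walk-from-isolated G iso (conn (suc v) zero)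
... | ()

connectedThreshold⇒dominating : ∀ {n} (G : Graph n) → 2 ≤ n → Threshold G → Connected G →
                                ∃ (Dominating G)
connectedThreshold⇒dominating G (s≤s (s≤s z≤n)) (add .G v (inj₁ iso) _) conn =
  ⊥-elim (connected⇒¬isolated G conn v iso)
connectedThreshold⇒dominating G (s≤s (s≤s z≤n)) (add .G v (inj₂ dom) _) conn = v , dom

twoAt : ∀ {n} → Fin n → Fin n → Fin 3
twoAt v w with w ≟ v
... | yes _ = suc (suc zero)
... | no  _ = zero

twoAt-here : ∀ {n} (v : Fin n) → twoAt v v ≡ suc (suc zero)
twoAt-here v with v ≟ v
... | yes _   = refl
... | no  v≢v = ⊥-elim (v≢v refl)

twoAt-elsewhere : ∀ {n} (v w : Fin n) → w ≢ v → twoAt v w ≡ zero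
twoAt-elsewhere v w w≢v with w ≟ v
... | yes w≡v = ⊥-elim (w≢v w≡v)
... | no  _   = refl

weight-twoAt : ∀ {n} (v : Fin n) → weight (twoAt v) ≡ 2
weight-twoAt v =
  trans (∑-supported-at _ v (λ w w≢v → cong toℕ (twoAt-elsewhere v w w≢v)))
        (cong toℕ (twoAt-here v))

dominating⇒isPID-twoAt : ∀ {n} (G : Graph n) v → Dominating G v → IsPID G (twoAt v)
dominating⇒isPID-twoAt G v dom u twoAt≡0 with u ≟ v
... | yes _ with () ← twoAt≡0
... | no u≢v = begin
  nbSum G (twoAt v) u                          ≡⟨ ∑-supported-at _ v off-v ⟩
  (if Adj G u v then toℕ (twoAt v v) else 0)   ≡⟨ cong (λ b → if b then _ else 0) u~v ⟩
  toℕ (twoAt v v)                              ≡⟨ cong toℕ (twoAt-here v) ⟩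
  2                                            ∎
  where
  open ≡-Reasoning
  u~v : Adj G u v ≡ true
  u~v = trans (Graph.sym G u v) (dom u u≢v)
  off-v : ∀ w → w ≢ v → (if Adj G u w then toℕ (twoAt v w) else 0) ≡ 0
  off-v w w≢v rewrite twoAt-elsewhere v w w≢v with Adj G u w
  ... | true  = refl
  ... | false = refl

proposition6 : (n : ℕ) (G : Graph n) → 2 ≤ n → Threshold G → Connected G →
                 γIp≡ G 2
proposition6 (suc (suc m)) G 2≤n@(s≤s (s≤s z≤n)) thr conn
  with v , dom ← connectedThreshold⇒dominating G 2≤n thr conn =
  (twoAt v , dominating⇒isPID-twoAt G v dom , weight-twoAt v) , isPID⇒2≤weight G
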